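{- For every integer $d\ge 2$, the Keller graph $G_d$ is Hamiltonian.
   Context: The Keller graph $G_d$ has as vertices the $4^d$ tuples in $\{0,1,2,3\}^d$; two tuples $u,v$ are adjacent iff they differ in at least two coordinates and there is at least one coordinate $i$ with $u_i-v_i\equiv 2\pmod 4$. -}

module Defs where

open import Data.Nat using (ℕ; zero; suc; _+_; _^_; _≤_; _%_)
open import Data.Fin using (Fin; toℕ; fromℕ<)
open import Data.Fin.Properties using (_≟_)
open import Data.Vec using (Vec; lookup)
open import Data.Product using (Σ; ∃; _×_)
open import Data.Nat.DivMod using (m%n<n)
open import Relation.Nullary using (¬_)
open import Relation.Nullary.Decidable using (does)
open import Relation.Binary.PropositionalEquality using (_≡_)
open import Function.Bundles using (_⤖_; Bijection)
open import Data.Bool using (true; false; if_then_else_)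

KVertex : ℕ → Set
KVertex d = Vec (Fin 4) d

hamming : ∀ {d} → KVertex d → KVertex d → ℕ
hamming {d} u v = go d (λ i → lookup u i) (λ i → lookup v i)
  where
  go : (n : ℕ) → (Fin n → Fin 4) → (Fin n → Fin 4) → ℕ
  go zero f g = 0
  go (suc n) f g =
    (if does (f Fin.zero ≟ g Fin.zero) then 0 else 1)
      + go n (λ i → f (Fin.suc i)) (λ i → g (Fin.suc i))

KAdj : ∀ {d} → KVertex d → KVertex d → Set
KAdj {d} u v =
  (2 ≤ hamming u v) ×
  (∃ λ (i : Fin d) → (toℕ (lookup u i) + 2) % 4 ≡ toℕ (lookup v i))

sucMod : ∀ {N} → Fin N → Fin N
sucMod {suc N} i = fromℕ< (m%n<n (suc (toℕ i)) (suc N))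

-- A graph on a finite vertex type V with N vertices is Hamiltonian if
-- there is a cyclic ordering of all vertices, each visited exactly once
-- (a bijection Fin N ⤖ V), with cyclically consecutive vertices adjacent,
-- and N ≥ 3 (so the closed walk is a genuine cycle).
Hamiltonian : (V : Set) (N : ℕ) (Adj : V → V → Set) → Set
Hamiltonian V N Adj =
  (3 ≤ N) ×
  Σ (Fin N ⤖ V) λ c →
    ∀ (i : Fin N) → Adj (Bijection.to c i) (Bijection.to c (sucMod i))

KellerHamiltonian : ℕ → Set
KellerHamiltonian d = Hamiltonian (KVertex d) (4 ^ d) KAdj

-- List {0,1,2,3}^d in base-4 counting order, the first coordinate being the least
-- significant digit.  Counting up by one adds 1 to the first digit and a carry c ∈ {0,1}
-- to the second, and wraps around from 33…3 to 00…0, so this is a cyclic enumeration.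
-- Consecutive tuples are not yet adjacent, so we relabel the vertices by the bijection
-- that acts on the first two coordinates by the matrix (2 1; 1 1), invertible over ℤ/4
-- (its determinant is 1).  It sends the step (1, c) to (2, 1) or (3, 2): both
-- coordinates change and one of them by 2, which is a Keller edge.
module Submission where

open import Defs
open import Data.Nat using (ℕ; _≤_)
open import Data.Nat as ℕ using (zero; suc; _+_; _*_; _^_; _<_; z≤n; s≤s; _%_; _/_; NonZero)
open import Data.Nat.Properties
open import Data.Nat.DivMod using (m%n<n; m≡m%n+[m/n]*n)
open import Data.Nat.GeneralisedArithmetic using (fold; fold-+)
open import Data.Fin as F using (Fin; toℕ; fromℕ<)
open import Data.Fin.Patterns using (0F; 1F; 2F; 3F)
open import Data.Fin.Properties using (toℕ-fromℕ<; toℕ-injective; toℕ<n; all?)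
open import Data.Vec using (Vec; []; _∷_; replicate)
open import Data.Product using (_×_; _,_; ∃)
open import Data.Product.Properties using (≡-dec)
open import Data.Sum using (_⊎_; inj₁; inj₂)
open import Function.Bundles using (_↔_; mk↔ₛ′)
open import Function.Construct.Composition using (_↔-∘_)
open import Function.Properties.Inverse using (↔⇒⤖)
open import Relation.Binary.PropositionalEquality
open import Relation.Nullary using (¬_)
open import Relation.Nullary.Decidable using (Dec; True; toWitness; dec-false; ¬?; _×-dec_; _⊎-dec_)

private
  variable
    n : ℕ

inc : Vec (Fin 4) n → Vec (Fin 4) n
inc []       = []
inc (0F ∷ w) = 1F ∷ w
inc (1F ∷ w) = 2F ∷ w
inc (2F ∷ w) = 3F ∷ w
inc (3F ∷ w) = 0F ∷ inc w

numeral : ∀ n → ℕ → Vec (Fin 4) n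
numeral n = fold (replicate n 0F) inc

value : Vec (Fin 4) n → ℕ
value []      = 0
value (a ∷ w) = toℕ a + 4 * value w

value< : (v : Vec (Fin 4) n) → value v < 4 ^ n
value< [] = s≤s z≤n
value< {suc n} (a ∷ w) = begin-strict
  toℕ a + 4 * value w   <⟨ +-monoˡ-< (4 * value w) (toℕ<n a) ⟩
  4 + 4 * value w       ≡⟨ *-suc 4 (value w) ⟨
  4 * suc (value w)     ≤⟨ *-monoʳ-≤ 4 (value< w) ⟩
  4 * 4 ^ n             ∎
  where open ≤-Reasoning

value-inc : (v : Vec (Fin 4) n) → suc (value v) < 4 ^ n → value (inc v) ≡ suc (value v)
value-inc [] (s≤s ())
value-inc (0F ∷ w) _ = refl
value-inc (1F ∷ w) _ = refl
value-inc (2F ∷ w) _ = refl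
value-inc {suc n} (3F ∷ w) lt = begin
  4 * value (inc w)   ≡⟨ cong (4 *_) (value-inc w (*-cancelˡ-< 4 _ _ lt′)) ⟩
  4 * suc (value w)   ≡⟨ *-suc 4 (value w) ⟩
  4 + 4 * value w     ∎
  where
  open ≡-Reasoning
  lt′ : 4 * suc (value w) < 4 * 4 ^ n
  lt′ = subst (_< 4 * 4 ^ n) (sym (*-suc 4 (value w))) lt

value-numeral : ∀ n x → x < 4 ^ n → value (numeral n x) ≡ x
value-numeral zero    zero    _  = refl
value-numeral (suc n) zero    _  = cong (4 *_) (value-numeral n zero (m^n>0 4 n))
value-numeral n       (suc x) lt = begin
  value (inc (numeral n x))  ≡⟨ value-inc (numeral n x) (subst (_< 4 ^ n) (cong suc (sym ih)) lt) ⟩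
  suc (value (numeral n x))  ≡⟨ cong suc ih ⟩
  suc x                      ∎
  where
  open ≡-Reasoning
  ih : value (numeral n x) ≡ x
  ih = value-numeral n x (<-trans (n<1+n x) lt)

numeral-4* : ∀ x → numeral (suc n) (4 * x) ≡ 0F ∷ numeral n x
numeral-4* zero = refl
numeral-4* {n} (suc x) = begin
  numeral (suc n) (4 * suc x)            ≡⟨ cong (numeral (suc n)) (*-suc 4 x) ⟩
  fold (numeral (suc n) (4 * x)) inc 4   ≡⟨ cong (λ v → fold v inc 4) (numeral-4* x) ⟩
  0F ∷ numeral n (suc x)                 ∎
  where open ≡-Reasoning

numeral-digit : ∀ (a : Fin 4) x → numeral (suc n) (toℕ a + 4 * x) ≡ a ∷ numeral n x
numeral-digit a x = begin
  numeral _ (toℕ a + 4 * x)              ≡⟨ fold-+ _ inc (toℕ a) ⟩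
  fold (numeral _ (4 * x)) inc (toℕ a)   ≡⟨ cong (λ v → fold v inc (toℕ a)) (numeral-4* x) ⟩
  fold (0F ∷ numeral _ x) inc (toℕ a)    ≡⟨ counted a ⟩
  a ∷ numeral _ x                        ∎
  where
  open ≡-Reasoning
  counted : ∀ {w : Vec (Fin 4) n} (a : Fin 4) → fold (0F ∷ w) inc (toℕ a) ≡ a ∷ w
  counted 0F = refl
  counted 1F = refl
  counted 2F = refl
  counted 3F = refl

numeral-value : (v : Vec (Fin 4) n) → numeral n (value v) ≡ v
numeral-value []      = refl
numeral-value (a ∷ w) = trans (numeral-digit a (value w)) (cong (a ∷_) (numeral-value w))

numeral-4^ : ∀ n → numeral n (4 ^ n) ≡ replicate n 0F
numeral-4^ zero    = refl
numeral-4^ (suc n) = trans (numeral-4* (4 ^ n)) (cong (0F ∷_) (numeral-4^ n))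

numeral-multiple : ∀ q → numeral n (q * 4 ^ n) ≡ replicate n 0F
numeral-multiple     zero    = refl
numeral-multiple {n} (suc q) = begin
  numeral n (4 ^ n + q * 4 ^ n)              ≡⟨ fold-+ _ inc (4 ^ n) ⟩
  fold (numeral n (q * 4 ^ n)) inc (4 ^ n)   ≡⟨ cong (λ v → fold v inc (4 ^ n)) (numeral-multiple q) ⟩
  numeral n (4 ^ n)                          ≡⟨ numeral-4^ n ⟩
  replicate n 0F                             ∎
  where open ≡-Reasoning

numeral-mod : ∀ n m .{{_ : NonZero (4 ^ n)}} → numeral n (m % 4 ^ n) ≡ numeral n m
numeral-mod n m = sym (begin
  numeral n m                                   ≡⟨ cong (numeral n) (m≡m%n+[m/n]*n m (4 ^ n)) ⟩
  numeral n (m % 4 ^ n + q * 4 ^ n)             ≡⟨ fold-+ _ inc (m % 4 ^ n) ⟩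
  fold (numeral n (q * 4 ^ n)) inc (m % 4 ^ n)  ≡⟨ cong (λ v → fold v inc (m % 4 ^ n)) (numeral-multiple q) ⟩
  numeral n (m % 4 ^ n)                         ∎)
  where
  open ≡-Reasoning
  q : ℕ
  q = m / 4 ^ n

base4 : ∀ n → Fin (4 ^ n) ↔ Vec (Fin 4) n
base4 n = mk↔ₛ′ (λ i → numeral n (toℕ i)) (λ v → fromℕ< (value< v))
  (λ v → trans (cong (numeral n) (toℕ-fromℕ< (value< v))) (numeral-value v))
  (λ i → toℕ-injective (trans (toℕ-fromℕ< _) (value-numeral n (toℕ i) (toℕ<n i))))

toℕ-sucMod : ∀ {N} .{{_ : NonZero N}} (i : Fin N) → toℕ (sucMod i) ≡ suc (toℕ i) % N
toℕ-sucMod {suc N} i = toℕ-fromℕ< _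

numeral-sucMod : (i : Fin (4 ^ n)) → numeral n (toℕ (sucMod i)) ≡ inc (numeral n (toℕ i))
numeral-sucMod {n} i = trans (cong (numeral n) (toℕ-sucMod i)) (numeral-mod n (suc (toℕ i)))
  where instance _ = m^n≢0 4 n

digit : ℕ → Fin 4
digit m = fromℕ< (m%n<n m 4)

mix unmix : Fin 4 × Fin 4 → Fin 4 × Fin 4
mix   (a , b) = digit (2 * toℕ a + toℕ b) , digit (toℕ a + toℕ b)
unmix (x , y) = digit (toℕ x + 3 * toℕ y) , digit (3 * toℕ x + 2 * toℕ y)

decide₂ : {P : Fin 4 → Fin 4 → Set} (P? : ∀ a b → Dec (P a b)) →
          {True (all? λ a → all? (P? a))} → ∀ a b → P a b
decide₂ P? {ok} = toWitness ok

mix-unmix : ∀ a b → mix (unmix (a , b)) ≡ (a , b)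
mix-unmix = decide₂ λ a b → ≡-dec F._≟_ F._≟_ (mix (unmix (a , b))) (a , b)

unmix-mix : ∀ a b → unmix (mix (a , b)) ≡ (a , b)
unmix-mix = decide₂ λ a b → ≡-dec F._≟_ F._≟_ (unmix (mix (a , b))) (a , b)

onHead₂ : ∀ {ℓ} {A : Set ℓ} → (A × A → A × A) → Vec A (2 + n) → Vec A (2 + n)
onHead₂ f (a ∷ b ∷ r) = let (x , y) = f (a , b) in x ∷ y ∷ r

onHead₂-inverse : ∀ {ℓ} {A : Set ℓ} {f g : A × A → A × A} →
                  (∀ a b → g (f (a , b)) ≡ (a , b)) →
                  (v : Vec A (2 + n)) → onHead₂ g (onHead₂ f v) ≡ v
onHead₂-inverse inv (a ∷ b ∷ r) = cong (λ (x , y) → x ∷ y ∷ r) (inv a b)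

mixHead : ∀ n → Vec (Fin 4) (2 + n) ↔ Vec (Fin 4) (2 + n)
mixHead n = mk↔ₛ′ (onHead₂ mix) (onHead₂ unmix) (onHead₂-inverse mix-unmix) (onHead₂-inverse unmix-mix)

Antipodal : Fin 4 → Fin 4 → Set
Antipodal x y = (toℕ x + 2) % 4 ≡ toℕ y

KAdj₂ : Fin 4 × Fin 4 → Fin 4 × Fin 4 → Set
KAdj₂ (x , y) (x′ , y′) = ¬ x ≡ x′ × ¬ y ≡ y′ × (Antipodal x x′ ⊎ Antipodal y y′)

KAdj₂? : ∀ p q → Dec (KAdj₂ p q)
KAdj₂? (x , y) (x′ , y′) =
  ¬? (x F.≟ x′) ×-dec ¬? (y F.≟ y′) ×-dec ((_ ℕ.≟ toℕ x′) ⊎-dec (_ ℕ.≟ toℕ y′))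

hamming-≥2 : ∀ {x y x′ y′ : Fin 4} (r r′ : Vec (Fin 4) n) →
             ¬ x ≡ x′ → ¬ y ≡ y′ → 2 ≤ hamming (x ∷ y ∷ r) (x′ ∷ y′ ∷ r′)
hamming-≥2 {x = x} {y} {x′} {y′} _ _ x≢x′ y≢y′
  rewrite dec-false (x F.≟ x′) x≢x′ | dec-false (y F.≟ y′) y≢y′ = s≤s (s≤s z≤n)

KAdj-onHead₂ : ∀ {x y x′ y′} {r r′ : Vec (Fin 4) n} →
               KAdj₂ (x , y) (x′ , y′) → KAdj (x ∷ y ∷ r) (x′ ∷ y′ ∷ r′)
KAdj-onHead₂ {r = r} {r′} (x≢x′ , y≢y′ , inj₁ eq) = hamming-≥2 r r′ x≢x′ y≢y′ , 0F , eq
KAdj-onHead₂ {r = r} {r′} (x≢x′ , y≢y′ , inj₂ eq) = hamming-≥2 r r′ x≢x′ y≢y′ , 1F , eq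

inc-onHead₂ : ∀ a b (r : Vec (Fin 4) n) →
              inc (a ∷ b ∷ r) ≡ sucMod a ∷ b ∷ r ⊎ ∃ λ r′ → inc (a ∷ b ∷ r) ≡ sucMod a ∷ sucMod b ∷ r′
inc-onHead₂ 0F b  r = inj₁ refl
inc-onHead₂ 1F b  r = inj₁ refl
inc-onHead₂ 2F b  r = inj₁ refl
inc-onHead₂ 3F 0F r = inj₂ (r , refl)
inc-onHead₂ 3F 1F r = inj₂ (r , refl)
inc-onHead₂ 3F 2F r = inj₂ (r , refl)
inc-onHead₂ 3F 3F r = inj₂ (inc r , refl)

mix-step : ∀ a b → KAdj₂ (mix (a , b)) (mix (sucMod a , b))
mix-step = decide₂ λ a b → KAdj₂? (mix (a , b)) (mix (sucMod a , b))

mix-step-carry : ∀ a b → KAdj₂ (mix (a , b)) (mix (sucMod a , sucMod b))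
mix-step-carry = decide₂ λ a b → KAdj₂? (mix (a , b)) (mix (sucMod a , sucMod b))

mix-inc : (v : Vec (Fin 4) (2 + n)) → KAdj (onHead₂ mix v) (onHead₂ mix (inc v))
mix-inc (a ∷ b ∷ r) with inc-onHead₂ a b r
... | inj₁ eq        rewrite eq = KAdj-onHead₂ (mix-step a b)
... | inj₂ (r′ , eq) rewrite eq = KAdj-onHead₂ (mix-step-carry a b)

theorem17 : (d : ℕ) → 2 ≤ d → KellerHamiltonian d
theorem17 (suc zero) (s≤s ())
theorem17 (suc (suc n)) _ = 3≤4^[2+n] , ↔⇒⤖ cycle , adjacent
  where
  3≤4^[2+n] : 3 ≤ 4 ^ (2 + n)
  3≤4^[2+n] = ≤-trans (s≤s (s≤s (s≤s z≤n))) (^-monoʳ-≤ 4 {2} {2 + n} (s≤s (s≤s z≤n)))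
  cycle : Fin (4 ^ (2 + n)) ↔ Vec (Fin 4) (2 + n)
  cycle = mixHead n ↔-∘ base4 (2 + n)
  adjacent : ∀ i → KAdj (onHead₂ mix (numeral _ (toℕ i))) (onHead₂ mix (numeral _ (toℕ (sucMod i))))
  adjacent i = subst (KAdj (onHead₂ mix (numeral _ (toℕ i))))
                     (cong (onHead₂ mix) (sym (numeral-sucMod i)))
                     (mix-inc (numeral _ (toℕ i)))
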